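{- A matroid $\mathsf{M}$ is isomorphic to a matroid of the form $\mathsf{U}_{0,m}\oplus\mathsf{U}_{r,s}\oplus\mathsf{U}_{\ell,\ell}$ (with integers $m,\ell\geq0$, $0\leq r\leq s$) if and only if $\mathsf{M}$ has no minor isomorphic to $\mathsf{T}_{2,4}$ nor to $\mathsf{U}_{1,2}\oplus\mathsf{U}_{1,2}$.
   Context: $\mathsf{U}_{r,s}$ is the uniform matroid of rank $r$ on $s$ elements. $\mathsf{T}_{2,4}$ is the cycle matroid of the graph obtained from a triangle by replacing one edge by two parallel edges (a rank-2 matroid on 4 elements; equivalently the matroid on $[4]$ whose bases are the 2-subsets $B$ with $|B\cap\{1,2\}|\geq1$). -}

module Defs where

open import Data.Nat using (ℕ; _≤_; _<_; _+_)
open import Data.Bool using (Bool; true; false; if_then_else_)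
open import Data.Fin using (Fin; zero; suc)
open import Data.Fin.Subset using (Subset; _∈_; _∉_; _⊆_; _∪_; ⁅_⁆; ⋃; ∣_∣)
import Data.Fin.Subset as S
open import Data.Vec using (Vec; lookup; tabulate; take; drop)
open import Data.List using (map; allFin)
open import Data.Product using (Σ; ∃; _×_; _,_)
open import Relation.Nullary using (¬_; Dec)
open import Relation.Binary.PropositionalEquality using (_≡_)
open import Function.Bundles using (_⇔_; _↔_; Inverse)
open import Function.Definitions using (Injective)

record Matroid (n : ℕ) : Set₁ where
  field
    Indep      : Subset n → Set
    indep?     : (I : Subset n) → Dec (Indep I)
    indep-∅    : Indep S.⊥
    indep-down : ∀ {I J} → J ⊆ I → Indep I → Indep J
    indep-aug  : ∀ {I J} → Indep I → Indep J → ∣ I ∣ < ∣ J ∣ →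
                 ∃ λ x → x ∈ J × x ∉ I × Indep (I ∪ ⁅ x ⁆)
open Matroid public

IndepPred : ℕ → Set₁
IndepPred k = Subset k → Set

U : ℕ → (s : ℕ) → IndepPred s
U r s I = ∣ I ∣ ≤ r

-- T_{2,4} on Fin 4 (elements 1,2,3,4 of the paper are zero..3 here).
-- Bases: 2-subsets meeting {1,2}; independent sets = subsets of bases.
T24 : IndepPred 4
T24 I = Σ (Subset 4) λ B → I ⊆ B × ∣ B ∣ ≡ 2 ×
          ((zero ∈ B) Data.Sum.⊎ (suc zero ∈ B))
  where import Data.Sum

_⊕_ : ∀ {a b} → IndepPred a → IndepPred b → IndepPred (a + b)
_⊕_ {a} P Q I = P (take a I) × Q (drop a I)

_≅_ : ∀ {n k} → Matroid n → IndepPred k → Set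
_≅_ {n} {k} M P = Σ (Fin n ↔ Fin k) λ e →
  ∀ (I : Subset n) → Indep M I ⇔ P (tabulate λ y → lookup I (Inverse.from e y))

image : ∀ {k n} → (Fin k → Fin n) → Subset k → Subset n
image f I = ⋃ (map (λ x → if lookup I x then ⁅ f x ⁆ else S.⊥) (allFin _))

IsBasisOf : ∀ {n} → Matroid n → Subset n → Subset n → Set
IsBasisOf M C B = B ⊆ C × Indep M B × (∀ x → x ∈ C → x ∉ B → ¬ Indep M (B ∪ ⁅ x ⁆))

-- M has a minor isomorphic to the matroid P on Fin k:
-- there are an injection f : Fin k → Fin n (onto the ground set X of the minor),
-- a set C disjoint from X (contracted; everything outside X ∪ C is deleted),
-- and a basis B of M|C such that I is independent in P iff f(I) ∪ B is independent in M
-- (standard description of the independent sets of M / C \ D).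
HasMinor : ∀ {n k} → Matroid n → IndepPred k → Set
HasMinor {n} {k} M P =
  Σ (Fin k → Fin n) λ f → Injective _≡_ _≡_ f ×
  Σ (Subset n) λ C → (∀ x → f x ∉ C) ×
  Σ (Subset n) λ B → IsBasisOf M C B ×
  (∀ (I : Subset k) → P I ⇔ Indep M (image f I ∪ B))

-- A matroid of the form U_{0,m} ⊕ U_{r,s} ⊕ U_{l,l} is described by a set of loops, a
-- "uniform" set and a rank: I is independent iff it contains no loop and meets the uniform
-- set in at most rank elements. In a loopless minor of such a matroid independence is
-- therefore governed by a count of uniform elements that grows by at most one per added
-- element, which is incompatible with the independent sets of T_{2,4} and U_{1,2} ⊕ U_{1,2}.
-- Conversely, let the uniform set consist of the elements that are neither loops nor
-- coloops, and let r be its rank. Suppose a circuit D of the uniform set had at most r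
-- elements; pick x ≠ y in D and extend D - y by some z to a basis B₁ of the uniform set.
-- Contracting K = B₁ - x - z leaves a rank-2 matroid in which x and y are parallel. An
-- element w independent of x there yields a T_{2,4} or a U_{1,2} ⊕ U_{1,2} minor on
-- {x, y, z, w}, and if there is no such w then z is a coloop. So every set of at most r
-- uniform elements is independent, and adding coloops preserves independence.

module Submission where

open import Defs
open import Data.Nat using (ℕ; zero; suc; _+_; _≤_; _<_; _≤?_; _<?_; _⊓_)
import Data.Nat as ℕ
open import Data.Nat.Properties
  using ( ≤-refl; ≤-trans; ≤-reflexive; ≤-pred; ≤-antisym; ≰⇒>; <⇒≱; ≮⇒≥; <-irrefl; n≮0; 1+n≰n; n≤1+n
        ; m≤m+n; +-suc; +-assoc; +-identityʳ; +-monoʳ-≤; m⊓n≤n; m⊓n≤m; ⊓-glb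
        ; +-0-commutativeMonoid; module ≤-Reasoning)
open import Data.Bool using (Bool; true; false; _∧_; if_then_else_)
open import Data.Bool.Properties using (∧-identityʳ; ∧-zeroʳ)
open import Data.Fin using (Fin; zero; suc; _≟_; _↑ˡ_; _↑ʳ_)
open import Data.Fin.Patterns using (0F; 1F; 2F; 3F)
open import Data.Fin.Properties using (suc-injective; any?; all?; splitAt-↑ˡ; splitAt-↑ʳ; +↔⊎; 1↔⊤)
open import Data.Fin.Subset
open import Data.Fin.Subset.Properties
open import Data.Vec using (Vec; []; _∷_; here; there; lookup; tabulate; take; drop)
open import Data.Vec.Properties using ([]=⇒lookup; lookup⇒[]=; lookup∘tabulate; lookup-zipWith)
open import Data.Vec.Relation.Unary.All using ([]; _∷_)
open import Data.Vec.Relation.Unary.All.Properties using (lookup⁺)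
open import Data.Vec.Relation.Unary.AllPairs using ([]; _∷_)
open import Data.Vec.Relation.Unary.Unique.Propositional.Properties using (lookup-injective)
open import Data.List using ([]; _∷_; map; allFin)
open import Data.List.Relation.Unary.Any using (here; there)
import Data.List.Membership.Propositional as List
open import Data.List.Membership.Propositional.Properties using (∈-allFin)
open import Data.Product using (Σ; ∃; _×_; _,_; proj₁; proj₂)
open import Data.Sum using (_⊎_; inj₁; inj₂; [_,_]′)
open import Data.Sum.Algebra using (⊎-cong)
open import Data.Unit using (tt) renaming (⊤ to Unit)
open import Data.Empty using (⊥-elim)
import Data.Empty as Empty
open import Relation.Nullary using (¬_; Dec; yes; no; does)
open import Relation.Nullary.Decidable
  using ( _×-dec_; _⊎-dec_; ¬?; decidable-stable; dec-true; dec-false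
        ; True; False; toWitness; toWitnessFalse; from-yes; from-no)
open import Relation.Binary.PropositionalEquality
open import Function using (id; _∘_; _$_)
open import Function.Bundles using (_⇔_; mk⇔; Equivalence; _↔_; Inverse; mk↔ₛ′)
open import Function.Definitions using (Injective)
open import Function.Properties.Inverse using (↔-refl; ↔-sym; ↔-trans)
open import Algebra.Properties.CommutativeMonoid.Sum +-0-commutativeMonoid using (sum; sum-permute; sum-cong-≗)

private variable
  k n : ℕ

infixl 5 _+ₛ_

_+ₛ_ : Subset n → Fin n → Subset n
p +ₛ x = p ∪ ⁅ x ⁆

module _ {p : Subset n} {x : Fin n} where

  x∈p+ₛx : x ∈ p +ₛ x
  x∈p+ₛx = x∈p∪q⁺ {p = p} (inj₂ (x∈⁅x⁆ x))

  p⊆p+ₛx : p ⊆ p +ₛ x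
  p⊆p+ₛx h = x∈p∪q⁺ (inj₁ h)

  y∈p+ₛx⁻ : ∀ {y} → y ∈ p +ₛ x → y ∈ p ⊎ y ≡ x
  y∈p+ₛx⁻ h with x∈p∪q⁻ p ⁅ x ⁆ h
  ... | inj₁ y∈p = inj₁ y∈p
  ... | inj₂ y∈x = inj₂ (x∈⁅y⁆⇒x≡y x y∈x)

  +ₛ-⊆ : ∀ {q} → p ⊆ q → x ∈ q → p +ₛ x ⊆ q
  +ₛ-⊆ p⊆q x∈q h with y∈p+ₛx⁻ h
  ... | inj₁ y∈p = p⊆q y∈p
  ... | inj₂ refl = x∈q

  ∉+ₛ : ∀ {y} → y ∉ p → y ≢ x → y ∉ p +ₛ x
  ∉+ₛ y∉p y≢x h = [ y∉p , y≢x ]′ (y∈p+ₛx⁻ h)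

+ₛ-comm : ∀ {p : Subset n} {x y} → p +ₛ y +ₛ x ⊆ p +ₛ x +ₛ y
+ₛ-comm h with y∈p+ₛx⁻ h
... | inj₂ refl = p⊆p+ₛx x∈p+ₛx
... | inj₁ h′ with y∈p+ₛx⁻ h′
...   | inj₂ refl = x∈p+ₛx
...   | inj₁ h″ = p⊆p+ₛx (p⊆p+ₛx h″)

x∈p-y⁻ : ∀ {p : Subset n} {x y} → x ∈ p - y → x ∈ p × x ≢ y
x∈p-y⁻ {p = p} {y = y} h = p─q⊆p p ⁅ y ⁆ h , λ { refl → x∈p─q⇒x∉q h (x∈⁅x⁆ y) }
  where
  x∈p─q⇒x∉q : ∀ {m} {p q : Subset m} {z} → z ∈ p ─ q → z ∉ q
  x∈p─q⇒x∉q {p = _ ∷ _} {inside ∷ _}  {zero} () here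
  x∈p─q⇒x∉q {p = _ ∷ _} {outside ∷ _} {zero} _ ()
  x∈p─q⇒x∉q {p = _ ∷ p} {_ ∷ q} {suc z} (there h) (there h′) = x∈p─q⇒x∉q {p = p} {q} h h′

⁅x⁆⊆p : ∀ {p : Subset n} {x} → x ∈ p → ⁅ x ⁆ ⊆ p
⁅x⁆⊆p {p = p} {x} x∈p h = subst (_∈ p) (sym (x∈⁅y⁆⇒x≡y x h)) x∈p

lookup≡true⇒∈ : ∀ {p : Subset n} {x} → lookup p x ≡ true → x ∈ p
lookup≡true⇒∈ {p = p} {x} = lookup⇒[]= x p

∈⇒lookup≡true : ∀ {p : Subset n} {x} → x ∈ p → lookup p x ≡ true
∈⇒lookup≡true = []=⇒lookup

∉⇒lookup≡false : ∀ {p : Subset n} {x} → x ∉ p → lookup p x ≡ false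
∉⇒lookup≡false {p = p} {x} x∉p with lookup p x in eq
... | true = ⊥-elim (x∉p (lookup≡true⇒∈ eq))
... | false = refl

module _ {P : Fin n → Set} (P? : ∀ x → Dec (P x)) where

  subset : Subset n
  subset = tabulate (does ∘ P?)

  ∈subset⁺ : ∀ {x} → P x → x ∈ subset
  ∈subset⁺ {x} Px = lookup≡true⇒∈ (trans (lookup∘tabulate _ x) (dec-true (P? x) Px))

  ∈subset⁻ : ∀ {x} → x ∈ subset → P x
  ∈subset⁻ {x} x∈ = decidable-stable (P? x) λ ¬Px →
    true≢false (trans (sym (∈⇒lookup≡true x∈)) (trans (lookup∘tabulate _ x) (dec-false (P? x) ¬Px)))
    where
    true≢false : true ≢ false
    true≢false ()

nonempty⊎≡⊥ : (p : Subset n) → (∃ λ x → x ∈ p) ⊎ p ≡ ⊥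
nonempty⊎≡⊥ p with nonempty? p
... | yes h = inj₁ h
... | no h = inj₂ (Empty-unique h)

∣q∣≡1+∣p∣ : ∀ (p q : Subset n) u → (∀ {y} → y ≢ u → y ∈ p → y ∈ q) →
            (∀ {y} → y ≢ u → y ∈ q → y ∈ p) → u ∉ p → u ∈ q → ∣ q ∣ ≡ suc ∣ p ∣
∣q∣≡1+∣p∣ (true ∷ p) (_ ∷ q) zero _ _ u∉p _ = ⊥-elim (u∉p here)
∣q∣≡1+∣p∣ (false ∷ p) (true ∷ q) zero p⊆q q⊆p _ _ =
  cong (suc ∘ ∣_∣) (⊆-antisym (λ h → drop-there (q⊆p (λ ()) (there h)))
                              (λ h → drop-there (p⊆q (λ ()) (there h))))
∣q∣≡1+∣p∣ (true ∷ p) (false ∷ q) (suc u) p⊆q _ _ _ with p⊆q {zero} (λ ()) here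
... | ()
∣q∣≡1+∣p∣ (false ∷ p) (true ∷ q) (suc u) _ q⊆p _ _ with q⊆p {zero} (λ ()) here
... | ()
∣q∣≡1+∣p∣ (true ∷ p) (true ∷ q) (suc u) p⊆q q⊆p u∉p (there u∈q) =
  cong suc (∣q∣≡1+∣p∣ p q u (λ ne h → drop-there (p⊆q (ne ∘ suc-injective) (there h)))
                            (λ ne h → drop-there (q⊆p (ne ∘ suc-injective) (there h)))
                            (u∉p ∘ there) u∈q)
∣q∣≡1+∣p∣ (false ∷ p) (false ∷ q) (suc u) p⊆q q⊆p u∉p (there u∈q) =
  ∣q∣≡1+∣p∣ p q u (λ ne h → drop-there (p⊆q (ne ∘ suc-injective) (there h)))
                  (λ ne h → drop-there (q⊆p (ne ∘ suc-injective) (there h)))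
                  (u∉p ∘ there) u∈q

∣p+ₛx∣≡1+∣p∣ : ∀ {p : Subset n} {x} → x ∉ p → ∣ p +ₛ x ∣ ≡ suc ∣ p ∣
∣p+ₛx∣≡1+∣p∣ {p = p} {x} x∉p =
  ∣q∣≡1+∣p∣ p (p +ₛ x) x (λ _ → p⊆p+ₛx) (λ y≢x h → [ id , ⊥-elim ∘ y≢x ]′ (y∈p+ₛx⁻ h)) x∉p x∈p+ₛx

∣p∣≡1+∣p-x∣ : ∀ {p : Subset n} {x} → x ∈ p → ∣ p ∣ ≡ suc ∣ p - x ∣
∣p∣≡1+∣p-x∣ {p = p} {x} x∈p =
  ∣q∣≡1+∣p∣ (p - x) p x (λ _ → proj₁ ∘ x∈p-y⁻) (λ y≢x h → x∈p∧x≢y⇒x∈p-y h y≢x)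
            (λ h → proj₂ (x∈p-y⁻ h) refl) x∈p

∣p+ₛx∩q∣≡1+∣p∩q∣ : ∀ {p q : Subset n} {x} → x ∉ p → x ∈ q → ∣ (p +ₛ x) ∩ q ∣ ≡ suc ∣ p ∩ q ∣
∣p+ₛx∩q∣≡1+∣p∩q∣ {p = p} {q} {x} x∉p x∈q =
  ∣q∣≡1+∣p∣ (p ∩ q) ((p +ₛ x) ∩ q) x
    (λ _ h → let y∈p , y∈q = x∈p∩q⁻ p q h in x∈p∩q⁺ (p⊆p+ₛx y∈p , y∈q))
    (λ y≢x h → let y∈px , y∈q = x∈p∩q⁻ (p +ₛ x) q h in
               x∈p∩q⁺ ([ id , ⊥-elim ∘ y≢x ]′ (y∈p+ₛx⁻ y∈px) , y∈q))
    (x∉p ∘ proj₁ ∘ x∈p∩q⁻ p q) (x∈p∩q⁺ (x∈p+ₛx , x∈q))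

p+ₛx∩q≡p∩q : ∀ {p q : Subset n} {x} → x ∉ q → (p +ₛ x) ∩ q ≡ p ∩ q
p+ₛx∩q≡p∩q {p = p} {q} {x} x∉q = ⊆-antisym
  (λ h → let y∈px , y∈q = x∈p∩q⁻ (p +ₛ x) q h in
         x∈p∩q⁺ ([ id , (λ { refl → ⊥-elim (x∉q y∈q) }) ]′ (y∈p+ₛx⁻ y∈px) , y∈q))
  (λ h → let y∈p , y∈q = x∈p∩q⁻ p q h in x∈p∩q⁺ (p⊆p+ₛx y∈p , y∈q))

⊆∧∣≥∣⇒⊇ : ∀ {p q : Subset n} → p ⊆ q → ∣ q ∣ ≤ ∣ p ∣ → q ⊆ p
⊆∧∣≥∣⇒⊇ {p = p} p⊆q ∣q∣≤∣p∣ {x} x∈q with x ∈? p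
... | yes x∈p = x∈p
... | no x∉p = ⊥-elim (<⇒≱ (p⊂q⇒∣p∣<∣q∣ (p⊆q , x , x∈q , x∉p)) ∣q∣≤∣p∣)

p⊆p-x+ₛx : ∀ {p : Subset n} {x} → x ∈ p → p ⊆ p - x +ₛ x
p⊆p-x+ₛx {x = x} x∈p {y} y∈p with y ≟ x
... | yes refl = x∈p+ₛx
... | no y≢x = p⊆p+ₛx (x∈p∧x≢y⇒x∈p-y y∈p y≢x)

module _ (M : Matroid n) where

  IsCircuit : Subset n → Set
  IsCircuit D = ¬ Indep M D × (∀ {x} → x ∈ D → Indep M (D - x))

  Coloop : Fin n → Set
  Coloop x = ∀ J → Indep M J → Indep M (J +ₛ x)

  coloop? : ∀ x → Dec (Coloop x)
  coloop? x with anySubset? (λ J → indep? M J ×-dec ¬? (indep? M (J +ₛ x)))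
  ... | yes (J , iJ , ¬iJx) = no λ col → ¬iJx (col J iJ)
  ... | no ∄J = yes λ J iJ → decidable-stable (indep? M (J +ₛ x)) (λ ¬iJx → ∄J (J , iJ , ¬iJx))

  maximal⇒∣J∣≤∣A∣ : ∀ {A J} → Indep M A → Indep M J →
                    (∀ {x} → x ∈ J → x ∈ A ⊎ ¬ Indep M (A +ₛ x)) → ∣ J ∣ ≤ ∣ A ∣
  maximal⇒∣J∣≤∣A∣ {A} {J} iA iJ maximal with ∣ J ∣ ≤? ∣ A ∣
  ... | yes ∣J∣≤∣A∣ = ∣J∣≤∣A∣
  ... | no ∣J∣≰∣A∣ with indep-aug M iA iJ (≰⇒> ∣J∣≰∣A∣)
  ...   | x , x∈J , x∉A , iAx = ⊥-elim ([ x∉A , (λ ¬iAx → ¬iAx iAx) ]′ (maximal x∈J))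

  augment : ∀ {A B} → Indep M A → Indep M B →
            ∃ λ I → A ⊆ I × I ⊆ A ∪ B × Indep M I × ∣ B ∣ ≤ ∣ I ∣
  augment {A₀} {B} iA₀ iB = go ∣ B ∣ A₀ (m≤m+n _ _) iA₀
    where
    go : ∀ fuel A → ∣ B ∣ ≤ fuel + ∣ A ∣ → Indep M A →
         ∃ λ I → A ⊆ I × I ⊆ A ∪ B × Indep M I × ∣ B ∣ ≤ ∣ I ∣
    go fuel A ∣B∣≤ iA with ∣ B ∣ ≤? ∣ A ∣
    ... | yes ∣B∣≤∣A∣ = A , id , p⊆p∪q B , iA , ∣B∣≤∣A∣
    ... | no ∣B∣≰∣A∣ with indep-aug M iA iB (≰⇒> ∣B∣≰∣A∣) | fuel
    ...   | _ , _ , _ , _ | zero = ⊥-elim (∣B∣≰∣A∣ ∣B∣≤)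
    ...   | x , x∈B , x∉A , iAx | suc fuel′
            with go fuel′ (A +ₛ x) (subst (∣ B ∣ ≤_) (sym ∣Ax∣+fuel′) ∣B∣≤) iAx
      where
      ∣Ax∣+fuel′ : fuel′ + ∣ A +ₛ x ∣ ≡ suc fuel′ + ∣ A ∣
      ∣Ax∣+fuel′ = trans (cong (fuel′ +_) (∣p+ₛx∣≡1+∣p∣ x∉A)) (+-suc fuel′ ∣ A ∣)
    ...     | I , Ax⊆I , I⊆AxB , iI , ∣B∣≤∣I∣ =
              I , ⊆-trans p⊆p+ₛx Ax⊆I , ⊆-trans I⊆AxB Ax∪B⊆A∪B , iI , ∣B∣≤∣I∣
      where
      Ax∪B⊆A∪B : (A +ₛ x) ∪ B ⊆ A ∪ B
      Ax∪B⊆A∪B h with x∈p∪q⁻ (A +ₛ x) B h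
      ... | inj₂ y∈B = x∈p∪q⁺ (inj₂ y∈B)
      ... | inj₁ y∈Ax with y∈p+ₛx⁻ y∈Ax
      ...   | inj₁ y∈A = x∈p∪q⁺ (inj₁ y∈A)
      ...   | inj₂ refl = x∈p∪q⁺ (inj₂ x∈B)

  max-indep-subset : ∀ R → ∃ λ B → B ⊆ R × Indep M B × (∀ J → J ⊆ R → Indep M J → ∣ J ∣ ≤ ∣ B ∣)
  max-indep-subset R = go n ⊥ (⊥-elim ∘ ∉⊥) (indep-∅ M) (m≤m+n n _)
    where
    go : ∀ fuel A → A ⊆ R → Indep M A → n ≤ fuel + ∣ A ∣ →
         ∃ λ B → B ⊆ R × Indep M B × (∀ J → J ⊆ R → Indep M J → ∣ J ∣ ≤ ∣ B ∣)
    go zero A A⊆R iA n≤∣A∣ = A , A⊆R , iA , λ J _ _ → ≤-trans (∣p∣≤n J) n≤∣A∣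
    go (suc fuel) A A⊆R iA n≤ with anySubset? (λ J → (J ⊆? R) ×-dec (indep? M J ×-dec (∣ A ∣ <? ∣ J ∣)))
    ... | yes (J , J⊆R , iJ , ∣A∣<∣J∣) =
          go fuel J J⊆R iJ (≤-trans n≤ (subst (_≤ fuel + ∣ J ∣) (+-suc fuel ∣ A ∣) (+-monoʳ-≤ fuel ∣A∣<∣J∣)))
    ... | no ∄J = A , A⊆R , iA , λ J J⊆R iJ → ≮⇒≥ λ ∣A∣<∣J∣ → ∄J (J , J⊆R , iJ , ∣A∣<∣J∣)

  dependent⇒circuit : ∀ {J} → ¬ Indep M J → ∃ λ D → D ⊆ J × IsCircuit D
  dependent⇒circuit {J} ¬iJ = go ∣ J ∣ J ≤-refl ¬iJ
    where
    go : ∀ fuel D → ∣ D ∣ ≤ fuel → ¬ Indep M D → ∃ λ D′ → D′ ⊆ D × IsCircuit D′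
    go fuel D ∣D∣≤ ¬iD with any? (λ x → (x ∈? D) ×-dec ¬? (indep? M (D - x)))
    go zero D ∣D∣≤ ¬iD | yes (x , x∈D , _) = ⊥-elim (n≮0 (subst (_≤ 0) (∣p∣≡1+∣p-x∣ x∈D) ∣D∣≤))
    go (suc fuel) D ∣D∣≤ ¬iD | yes (x , x∈D , ¬iDx)
      with go fuel (D - x) (≤-pred (subst (_≤ suc fuel) (∣p∣≡1+∣p-x∣ x∈D) ∣D∣≤)) ¬iDx
    ... | D′ , D′⊆D-x , circ = D′ , proj₁ ∘ x∈p-y⁻ ∘ D′⊆D-x , circ
    go fuel D ∣D∣≤ ¬iD | no ∄x =
      D , id , ¬iD , λ {x} x∈D → decidable-stable (indep? M (D - x)) λ ¬iDx → ∄x (x , x∈D , ¬iDx)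

  indep-∪-coloops : ∀ I J → Indep M J → (∀ {x} → x ∈ I → x ∈ J ⊎ Coloop x) → Indep M (J ∪ I)
  indep-∪-coloops I₀ J iJ I₀⊆J∪coloops = go ∣ I₀ ∣ I₀ ≤-refl I₀⊆J∪coloops
    where
    go : ∀ fuel I → ∣ I ∣ ≤ fuel → (∀ {x} → x ∈ I → x ∈ J ⊎ Coloop x) → Indep M (J ∪ I)
    go fuel I ∣I∣≤ I⊆ with nonempty⊎≡⊥ I
    ... | inj₂ refl = indep-down M (λ h → [ id , ⊥-elim ∘ ∉⊥ ]′ (x∈p∪q⁻ J ⊥ h)) iJ
    ... | inj₁ (x , x∈I) with fuel
    ...   | zero = ⊥-elim (n≮0 (subst (_≤ 0) (∣p∣≡1+∣p-x∣ x∈I) ∣I∣≤))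
    ...   | suc fuel′ =
            [ (λ x∈J → indep-down M (+ₛ-⊆ id (x∈p∪q⁺ (inj₁ x∈J)) ∘ J∪I⊆) iJ∪I-x) ,
              (λ col → indep-down M J∪I⊆ (col _ iJ∪I-x)) ]′ (I⊆ x∈I)
      where
      iJ∪I-x : Indep M (J ∪ (I - x))
      iJ∪I-x = go fuel′ (I - x) (≤-pred (subst (_≤ suc fuel′) (∣p∣≡1+∣p-x∣ x∈I) ∣I∣≤))
                  (I⊆ ∘ proj₁ ∘ x∈p-y⁻)
      J∪I⊆ : J ∪ I ⊆ J ∪ (I - x) +ₛ x
      J∪I⊆ h with x∈p∪q⁻ J I h
      ... | inj₁ y∈J = p⊆p+ₛx (x∈p∪q⁺ (inj₁ y∈J))
      ... | inj₂ y∈I with y∈p+ₛx⁻ (p⊆p-x+ₛx x∈I y∈I)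
      ...   | inj₁ y∈I-x = p⊆p+ₛx (x∈p∪q⁺ (inj₂ y∈I-x))
      ...   | inj₂ refl = x∈p+ₛx

∈⋃-map⁻ : ∀ {A : Set} (g : A → Subset n) xs {y} → y ∈ ⋃ (map g xs) → ∃ λ a → y ∈ g a
∈⋃-map⁻ g [] h = ⊥-elim (∉⊥ h)
∈⋃-map⁻ g (a ∷ as) h with x∈p∪q⁻ (g a) (⋃ (map g as)) h
... | inj₁ y∈ga = a , y∈ga
... | inj₂ y∈rest = ∈⋃-map⁻ g as y∈rest

∈⋃-map⁺ : ∀ {A : Set} (g : A → Subset n) {xs a y} → a List.∈ xs → y ∈ g a → y ∈ ⋃ (map g xs)
∈⋃-map⁺ g (here refl) h = x∈p∪q⁺ (inj₁ h)
∈⋃-map⁺ g {a′ ∷ _} (there a∈xs) h = x∈p∪q⁺ {p = g a′} (inj₂ (∈⋃-map⁺ g a∈xs h))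

module _ (f : Fin k → Fin n) where

  ∈image⁻ : ∀ {I y} → y ∈ image f I → ∃ λ i → i ∈ I × f i ≡ y
  ∈image⁻ {I} h with ∈⋃-map⁻ (λ i → if lookup I i then ⁅ f i ⁆ else ⊥) (allFin k) h
  ... | i , y∈ with lookup I i in eq
  ...   | true = i , lookup≡true⇒∈ eq , sym (x∈⁅y⁆⇒x≡y (f i) y∈)
  ...   | false = ⊥-elim (∉⊥ y∈)

  ∈image⁺ : ∀ {I i} → i ∈ I → f i ∈ image f I
  ∈image⁺ {I} {i} i∈I =
    ∈⋃-map⁺ (λ i → if lookup I i then ⁅ f i ⁆ else ⊥) (∈-allFin i) f-i∈
    where
    f-i∈ : f i ∈ (if lookup I i then ⁅ f i ⁆ else ⊥)
    f-i∈ rewrite ∈⇒lookup≡true i∈I = x∈⁅x⁆ (f i)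

  image-∪-⊆ : ∀ {I B T} → B ⊆ T → (∀ {i} → i ∈ I → f i ∈ T) → image f I ∪ B ⊆ T
  image-∪-⊆ {I} {B} B⊆T fI⊆T h with x∈p∪q⁻ (image f I) B h
  ... | inj₂ y∈B = B⊆T y∈B
  ... | inj₁ y∈fI with ∈image⁻ y∈fI
  ...   | i , i∈I , refl = fI⊆T i∈I

  image-+ₛ : ∀ I i B → image f (I +ₛ i) ∪ B ≡ image f I ∪ B +ₛ f i
  image-+ₛ I i B = ⊆-antisym
    (image-∪-⊆ (p⊆p+ₛx ∘ q⊆p∪q (image f I) B) (λ j∈Ii → case (y∈p+ₛx⁻ j∈Ii)))
    (+ₛ-⊆ (image-∪-⊆ (q⊆p∪q _ B) (λ j∈I → x∈p∪q⁺ (inj₁ (∈image⁺ {I +ₛ i} (p⊆p+ₛx j∈I)))))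
          (x∈p∪q⁺ (inj₁ (∈image⁺ {I +ₛ i} x∈p+ₛx))))
    where
    case : ∀ {j} → j ∈ I ⊎ j ≡ i → f j ∈ image f I ∪ B +ₛ f i
    case (inj₁ j∈I) = p⊆p+ₛx (x∈p∪q⁺ (inj₁ (∈image⁺ j∈I)))
    case (inj₂ refl) = x∈p+ₛx

  f∉image-∪ : Injective _≡_ _≡_ f → ∀ {I B i} → (∀ j → f j ∉ B) → i ∉ I → f i ∉ image f I ∪ B
  f∉image-∪ f-inj {I} {B} {i} f∉B i∉I h with x∈p∪q⁻ (image f I) B h
  ... | inj₂ fi∈B = f∉B i fi∈B
  ... | inj₁ fi∈fI with ∈image⁻ fi∈fI
  ...   | j , j∈I , fj≡fi = i∉I (subst (_∈ I) (f-inj fj≡fi) j∈I)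

T24? : (I : Subset 4) → Dec (T24 I)
T24? I = anySubset? λ B → (I ⊆? B) ×-dec ((∣ B ∣ ℕ.≟ 2) ×-dec ((zero ∈? B) ⊎-dec (suc zero ∈? B)))

U12⊕U12? : (I : Subset 4) → Dec ((U 1 2 ⊕ U 1 2) I)
U12⊕U12? I = (_ ≤? 1) ×-dec (_ ≤? 1)

-- Up to relabelling this is U_{0,m} ⊕ U_{rank ⊓ s,s} ⊕ U_{l,l}, with the loops, the uniform
-- elements and the remaining elements (coloops) as the three summands.
record StandardForm (M : Matroid n) : Set where
  field
    loops uniform : Subset n
    rank          : ℕ
    loop∉uniform  : ∀ {x} → x ∈ loops → x ∉ uniform
    indep⇔        : ∀ I → Indep M I ⇔ ((∀ {x} → x ∈ I → x ∉ loops) × ∣ I ∩ uniform ∣ ≤ rank)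

lookup-take : ∀ {A : Set} a {b} (v : Vec A (a + b)) (i : Fin a) → lookup (take a v) i ≡ lookup v (i ↑ˡ b)
lookup-take (suc a) (x ∷ v) zero = refl
lookup-take (suc a) (x ∷ v) (suc i) = lookup-take a v i

lookup-drop : ∀ {A : Set} a {b} (v : Vec A (a + b)) (i : Fin b) → lookup (drop a v) i ≡ lookup v (a ↑ʳ i)
lookup-drop zero v i = refl
lookup-drop (suc a) (x ∷ v) i = lookup-drop a v i

indicator : Bool → ℕ
indicator true = 1
indicator false = 0

∣p∣≡sum : (p : Subset n) → ∣ p ∣ ≡ sum (indicator ∘ lookup p)
∣p∣≡sum [] = refl
∣p∣≡sum (true ∷ p) = cong suc (∣p∣≡sum p)
∣p∣≡sum (false ∷ p) = ∣p∣≡sum p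

sum-++ : ∀ a b (g : Fin (a + b) → ℕ) → sum g ≡ sum (g ∘ (_↑ˡ b)) + sum (g ∘ (a ↑ʳ_))
sum-++ zero b g = refl
sum-++ (suc a) b g = trans (cong (g zero +_) (sum-++ a b (g ∘ suc))) (sym (+-assoc (g zero) _ _))

sum-zero : ∀ {k} (g : Fin k → ℕ) → (∀ i → g i ≡ 0) → sum g ≡ 0
sum-zero {zero} g g≡0 = refl
sum-zero {suc k} g g≡0 = cong₂ _+_ (g≡0 zero) (sum-zero (g ∘ suc) (g≡0 ∘ suc))

data Block : Set where
  loopBlock uniformBlock freeBlock : Block

Sizes : Set
Sizes = ℕ × ℕ × ℕ

Blocks : Sizes → Set
Blocks (a , b , c) = (Fin a ⊎ Fin b) ⊎ Fin c

blockOf : ∀ {d} → Blocks d → Block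
blockOf (inj₁ (inj₁ _)) = loopBlock
blockOf (inj₁ (inj₂ _)) = uniformBlock
blockOf (inj₂ _) = freeBlock

grow : Block → Sizes → Sizes
grow loopBlock (a , b , c) = suc a , b , c
grow uniformBlock (a , b , c) = a , suc b , c
grow freeBlock (a , b , c) = a , b , suc c

push : ∀ k d → (Unit ⊎ Blocks d) ↔ Blocks (grow k d)
push loopBlock d = mk↔ₛ′
  (λ { (inj₁ _) → inj₁ (inj₁ zero) ; (inj₂ (inj₁ (inj₁ i))) → inj₁ (inj₁ (suc i))
     ; (inj₂ (inj₁ (inj₂ j))) → inj₁ (inj₂ j) ; (inj₂ (inj₂ k)) → inj₂ k })
  (λ { (inj₁ (inj₁ zero)) → inj₁ tt ; (inj₁ (inj₁ (suc i))) → inj₂ (inj₁ (inj₁ i))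
     ; (inj₁ (inj₂ j)) → inj₂ (inj₁ (inj₂ j)) ; (inj₂ k) → inj₂ (inj₂ k) })
  (λ { (inj₁ (inj₁ zero)) → refl ; (inj₁ (inj₁ (suc i))) → refl ; (inj₁ (inj₂ j)) → refl ; (inj₂ k) → refl })
  (λ { (inj₁ tt) → refl ; (inj₂ (inj₁ (inj₁ i))) → refl ; (inj₂ (inj₁ (inj₂ j))) → refl ; (inj₂ (inj₂ k)) → refl })
push uniformBlock d = mk↔ₛ′
  (λ { (inj₁ _) → inj₁ (inj₂ zero) ; (inj₂ (inj₁ (inj₁ i))) → inj₁ (inj₁ i)
     ; (inj₂ (inj₁ (inj₂ j))) → inj₁ (inj₂ (suc j)) ; (inj₂ (inj₂ k)) → inj₂ k })
  (λ { (inj₁ (inj₂ zero)) → inj₁ tt ; (inj₁ (inj₂ (suc j))) → inj₂ (inj₁ (inj₂ j))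
     ; (inj₁ (inj₁ i)) → inj₂ (inj₁ (inj₁ i)) ; (inj₂ k) → inj₂ (inj₂ k) })
  (λ { (inj₁ (inj₂ zero)) → refl ; (inj₁ (inj₂ (suc j))) → refl ; (inj₁ (inj₁ i)) → refl ; (inj₂ k) → refl })
  (λ { (inj₁ tt) → refl ; (inj₂ (inj₁ (inj₁ i))) → refl ; (inj₂ (inj₁ (inj₂ j))) → refl ; (inj₂ (inj₂ k)) → refl })
push freeBlock d = mk↔ₛ′
  (λ { (inj₁ _) → inj₂ zero ; (inj₂ (inj₁ w)) → inj₁ w ; (inj₂ (inj₂ k)) → inj₂ (suc k) })
  (λ { (inj₂ zero) → inj₁ tt ; (inj₂ (suc k)) → inj₂ (inj₂ k) ; (inj₁ w) → inj₂ (inj₁ w) })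
  (λ { (inj₂ zero) → refl ; (inj₂ (suc k)) → refl ; (inj₁ w) → refl })
  (λ { (inj₁ tt) → refl ; (inj₂ (inj₁ w)) → refl ; (inj₂ (inj₂ k)) → refl })

push-new : ∀ k d → blockOf {grow k d} (Inverse.to (push k d) (inj₁ tt)) ≡ k
push-new loopBlock d = refl
push-new uniformBlock d = refl
push-new freeBlock d = refl

push-old : ∀ k d (w : Blocks d) → blockOf {grow k d} (Inverse.to (push k d) (inj₂ w)) ≡ blockOf w
push-old loopBlock d (inj₁ (inj₁ _)) = refl
push-old loopBlock d (inj₁ (inj₂ _)) = refl
push-old loopBlock d (inj₂ _) = refl
push-old uniformBlock d (inj₁ (inj₁ _)) = refl
push-old uniformBlock d (inj₁ (inj₂ _)) = refl
push-old uniformBlock d (inj₂ _) = refl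
push-old freeBlock d (inj₁ (inj₁ _)) = refl
push-old freeBlock d (inj₁ (inj₂ _)) = refl
push-old freeBlock d (inj₂ _) = refl

size : Sizes → ℕ
size (a , b , c) = (a + b) + c

Fin↔Blocks : ∀ d → Fin (size d) ↔ Blocks d
Fin↔Blocks (a , b , c) = ↔-trans +↔⊎ (⊎-cong +↔⊎ ↔-refl)

block : ∀ d → Fin (size d) → Block
block d = blockOf ∘ Inverse.to (Fin↔Blocks d)

sortBlocks : ∀ n (t : Fin n → Block) →
             Σ Sizes λ d → Σ (Fin n ↔ Blocks d) λ e → ∀ x → blockOf (Inverse.to e x) ≡ t x
sortBlocks zero t = (0 , 0 , 0) , mk↔ₛ′ (λ ()) (λ { (inj₁ (inj₁ ())) ; (inj₁ (inj₂ ())) ; (inj₂ ()) })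
                                       (λ { (inj₁ (inj₁ ())) ; (inj₁ (inj₂ ())) ; (inj₂ ()) }) (λ ()) , λ ()
sortBlocks (suc n) t with sortBlocks n (t ∘ suc)
... | d , e , e-block = grow (t zero) d , ↔-trans Fin-suc↔ (↔-trans (⊎-cong ↔-refl e) (push (t zero) d)) , blocks
  where
  Fin-suc↔ : Fin (suc n) ↔ (Unit ⊎ Fin n)
  Fin-suc↔ = ↔-trans +↔⊎ (⊎-cong 1↔⊤ ↔-refl)
  blocks : ∀ x → blockOf (Inverse.to (push (t zero) d) (Inverse.to (⊎-cong ↔-refl e) (Inverse.to Fin-suc↔ x))) ≡ t x
  blocks zero = push-new (t zero) d
  blocks (suc x) = trans (push-old (t zero) d (Inverse.to e x)) (e-block x)

sort : ∀ n (t : Fin n → Block) → Σ Sizes λ d → Σ (Fin n ↔ Fin (size d)) λ e → ∀ x → block d (Inverse.to e x) ≡ t x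
sort n t with sortBlocks n t
... | d , e , e-block = d , ↔-trans e (↔-sym (Fin↔Blocks d)) ,
      λ x → trans (cong blockOf (Inverse.strictlyInverseˡ (Fin↔Blocks d) (Inverse.to e x))) (e-block x)

isUniform : Block → Bool
isUniform uniformBlock = true
isUniform _ = false

module BlockCounting {a b c : ℕ} (e : Fin n ↔ Fin ((a + b) + c)) (L R : Subset n)
  (∈L⇔ : ∀ {x} → x ∈ L ⇔ block (a , b , c) (Inverse.to e x) ≡ loopBlock)
  (∈R⇔ : ∀ {x} → x ∈ R ⇔ block (a , b , c) (Inverse.to e x) ≡ uniformBlock) where

  private
    to : Fin n → Fin ((a + b) + c)
    to = Inverse.to e
    from : Fin ((a + b) + c) → Fin n
    from = Inverse.from e
    blk : Fin ((a + b) + c) → Block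
    blk = block (a , b , c)

  blk-to-from : ∀ y → blk (to (from y)) ≡ blk y
  blk-to-from y = cong blk (Inverse.strictlyInverseˡ e y)

  -- The transport of subsets used in the definition of _≅_.
  relabel : Subset n → Subset ((a + b) + c)
  relabel I = tabulate (lookup I ∘ from)

  loopPart : Subset n → Subset a
  loopPart I = take a (take (a + b) (relabel I))

  uniformPart : Subset n → Subset b
  uniformPart I = drop a (take (a + b) (relabel I))

  block-loop : ∀ i → blk ((i ↑ˡ b) ↑ˡ c) ≡ loopBlock
  block-loop i rewrite splitAt-↑ˡ (a + b) (i ↑ˡ b) c | splitAt-↑ˡ a i b = refl

  block-uniform : ∀ j → blk ((a ↑ʳ j) ↑ˡ c) ≡ uniformBlock
  block-uniform j rewrite splitAt-↑ˡ (a + b) (a ↑ʳ j) c | splitAt-↑ʳ a b j = refl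

  block-free : ∀ k → blk ((a + b) ↑ʳ k) ≡ freeBlock
  block-free k rewrite splitAt-↑ʳ (a + b) c k = refl

  block≡loop⇒ : ∀ y → blk y ≡ loopBlock → ∃ λ i → y ≡ (i ↑ˡ b) ↑ˡ c
  block≡loop⇒ y blk-y with Inverse.to (Fin↔Blocks (a , b , c)) y in eq
  ... | inj₁ (inj₁ i) = i , trans (sym (Inverse.strictlyInverseʳ (Fin↔Blocks (a , b , c)) y))
                                  (cong (Inverse.from (Fin↔Blocks (a , b , c))) eq)

  lookup-loopPart : ∀ I i → lookup (loopPart I) i ≡ lookup I (from ((i ↑ˡ b) ↑ˡ c))
  lookup-loopPart I i = trans (lookup-take a (take (a + b) (relabel I)) i)
    (trans (lookup-take (a + b) (relabel I) (i ↑ˡ b)) (lookup∘tabulate (lookup I ∘ from) _))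

  lookup-uniformPart : ∀ I j → lookup (uniformPart I) j ≡ lookup I (from ((a ↑ʳ j) ↑ˡ c))
  lookup-uniformPart I j = trans (lookup-drop a (take (a + b) (relabel I)) j)
    (trans (lookup-take (a + b) (relabel I) (a ↑ʳ j)) (lookup∘tabulate (lookup I ∘ from) _))

  ∣loopPart∣≤0⇔loopless : ∀ I → ∣ loopPart I ∣ ≤ 0 ⇔ (∀ {x} → x ∈ I → x ∉ L)
  ∣loopPart∣≤0⇔loopless I = mk⇔ ⇒ ⇐
    where
    ⇒ : ∣ loopPart I ∣ ≤ 0 → ∀ {x} → x ∈ I → x ∉ L
    ⇒ ∣loops∣≤0 {x} x∈I x∈L with block≡loop⇒ (to x) (Equivalence.to ∈L⇔ x∈L)
    ... | i , to-x≡i = n≮0 (subst (_≤ 0) (∣⁅x⁆∣≡1 i) (≤-trans (p⊆q⇒∣p∣≤∣q∣ {p = ⁅ i ⁆} (⁅x⁆⊆p i∈loops)) ∣loops∣≤0))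
      where
      i∈loops : i ∈ loopPart I
      i∈loops = lookup≡true⇒∈ (trans (lookup-loopPart I i) (trans (cong (lookup I ∘ from) (sym to-x≡i))
                  (trans (cong (lookup I) (Inverse.strictlyInverseʳ e x)) (∈⇒lookup≡true x∈I))))
    ⇐ : (∀ {x} → x ∈ I → x ∉ L) → ∣ loopPart I ∣ ≤ 0
    ⇐ loopless with nonempty⊎≡⊥ (loopPart I)
    ... | inj₂ loops≡⊥ = ≤-reflexive (trans (cong ∣_∣ loops≡⊥) (∣⊥∣≡0 a))
    ... | inj₁ (i , i∈loops) = ⊥-elim (loopless x∈I (Equivalence.from ∈L⇔ blk-to-x))
      where
      x∈I : from ((i ↑ˡ b) ↑ˡ c) ∈ I
      x∈I = lookup≡true⇒∈ (trans (sym (lookup-loopPart I i)) (∈⇒lookup≡true i∈loops))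
      blk-to-x : blk (to (from ((i ↑ˡ b) ↑ˡ c))) ≡ loopBlock
      blk-to-x = trans (blk-to-from _) (block-loop i)

  lookup-R : ∀ y → lookup R (from y) ≡ isUniform (blk y)
  lookup-R y with blk y in blk-y
  ... | uniformBlock = ∈⇒lookup≡true (Equivalence.from ∈R⇔ (trans (blk-to-from y) blk-y))
  ... | loopBlock = ∉⇒lookup≡false λ x∈R → loop≢uniform (trans (sym (trans (blk-to-from y) blk-y)) (Equivalence.to ∈R⇔ x∈R))
    where
    loop≢uniform : loopBlock ≢ uniformBlock
    loop≢uniform ()
  ... | freeBlock = ∉⇒lookup≡false λ x∈R → free≢uniform (trans (sym (trans (blk-to-from y) blk-y)) (Equivalence.to ∈R⇔ x∈R))
    where
    free≢uniform : freeBlock ≢ uniformBlock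
    free≢uniform ()

  ∣uniformPart∣≡∣I∩R∣ : ∀ I → ∣ uniformPart I ∣ ≡ ∣ I ∩ R ∣
  ∣uniformPart∣≡∣I∩R∣ I = begin
      ∣ uniformPart I ∣
    ≡⟨ ∣p∣≡sum (uniformPart I) ⟩
      sum (indicator ∘ lookup (uniformPart I))
    ≡⟨ sum-cong-≗ (cong indicator ∘ lookup-uniformPart I) ⟩
      sum (λ j → indicator (lookup I (from ((a ↑ʳ j) ↑ˡ c))))
    ≡⟨ sum-cong-≗ h-uniform ⟨
      sum (λ j → h ((a ↑ʳ j) ↑ˡ c))
    ≡⟨ cong (_+ sum (λ j → h ((a ↑ʳ j) ↑ˡ c))) (sum-zero _ h-loop) ⟨
      sum (λ i → h ((i ↑ˡ b) ↑ˡ c)) + sum (λ j → h ((a ↑ʳ j) ↑ˡ c))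
    ≡⟨ sum-++ a b (λ u → h (u ↑ˡ c)) ⟨
      sum (λ u → h (u ↑ˡ c))
    ≡⟨ +-identityʳ _ ⟨
      sum (λ u → h (u ↑ˡ c)) + 0
    ≡⟨ cong (sum (λ u → h (u ↑ˡ c)) +_) (sum-zero _ h-free) ⟨
      sum (λ u → h (u ↑ˡ c)) + sum (λ k → h ((a + b) ↑ʳ k))
    ≡⟨ sum-++ (a + b) c h ⟨
      sum h
    ≡⟨ sum-cong-≗ (λ y → cong (λ t → indicator (lookup I (from y) ∧ t)) (lookup-R y)) ⟨
      sum (λ y → indicator (lookup I (from y) ∧ lookup R (from y)))
    ≡⟨ sum-permute (λ x → indicator (lookup I x ∧ lookup R x)) (↔-sym e) ⟨
      sum (λ x → indicator (lookup I x ∧ lookup R x))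
    ≡⟨ sum-cong-≗ (λ x → cong indicator (lookup-zipWith _∧_ x I R)) ⟨
      sum (indicator ∘ lookup (I ∩ R))
    ≡⟨ ∣p∣≡sum (I ∩ R) ⟨
      ∣ I ∩ R ∣ ∎
    where
    open ≡-Reasoning
    h : Fin ((a + b) + c) → ℕ
    h y = indicator (lookup I (from y) ∧ isUniform (blk y))
    h-loop : ∀ i → h ((i ↑ˡ b) ↑ˡ c) ≡ 0
    h-loop i rewrite block-loop i = cong indicator (∧-zeroʳ _)
    h-uniform : ∀ j → h ((a ↑ʳ j) ↑ˡ c) ≡ indicator (lookup I (from ((a ↑ʳ j) ↑ˡ c)))
    h-uniform j rewrite block-uniform j = cong indicator (∧-identityʳ _)
    h-free : ∀ k → h ((a + b) ↑ʳ k) ≡ 0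
    h-free k rewrite block-free k = cong indicator (∧-zeroʳ _)

_≟ᴮ_ : ∀ (k k′ : Block) → Dec (k ≡ k′)
loopBlock ≟ᴮ loopBlock = yes refl
uniformBlock ≟ᴮ uniformBlock = yes refl
freeBlock ≟ᴮ freeBlock = yes refl
loopBlock ≟ᴮ uniformBlock = no λ ()
loopBlock ≟ᴮ freeBlock = no λ ()
uniformBlock ≟ᴮ loopBlock = no λ ()
uniformBlock ≟ᴮ freeBlock = no λ ()
freeBlock ≟ᴮ loopBlock = no λ ()
freeBlock ≟ᴮ uniformBlock = no λ ()

≅⇒standardForm : ∀ {M : Matroid n} {m r s l} → M ≅ ((U 0 m ⊕ U r s) ⊕ U l l) → StandardForm M
≅⇒standardForm {n} {M} {m} {r} {s} {l} (e , M⇔) = record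
  { loops = subset loop? ; uniform = subset uniform? ; rank = r
  ; loop∉uniform = λ x∈L x∈U → loop≢uniform (trans (sym (∈subset⁻ loop? x∈L)) (∈subset⁻ uniform? x∈U))
  ; indep⇔ = λ I → mk⇔ (to I) (from I)
  }
  where
  loop? : ∀ x → Dec (block (m , s , l) (Inverse.to e x) ≡ loopBlock)
  loop? x = block (m , s , l) (Inverse.to e x) ≟ᴮ loopBlock
  uniform? : ∀ x → Dec (block (m , s , l) (Inverse.to e x) ≡ uniformBlock)
  uniform? x = block (m , s , l) (Inverse.to e x) ≟ᴮ uniformBlock
  loop≢uniform : loopBlock ≢ uniformBlock
  loop≢uniform ()
  open BlockCounting e (subset loop?) (subset uniform?) (mk⇔ (∈subset⁻ loop?) (∈subset⁺ loop?))
                                                      (mk⇔ (∈subset⁻ uniform?) (∈subset⁺ uniform?))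
  to : ∀ I → Indep M I → (∀ {x} → x ∈ I → x ∉ subset loop?) × ∣ I ∩ subset uniform? ∣ ≤ r
  to I iI with Equivalence.to (M⇔ I) iI
  ... | (∣loops∣≤0 , ∣uniform∣≤r) , _ =
        Equivalence.to (∣loopPart∣≤0⇔loopless I) ∣loops∣≤0 , subst (_≤ r) (∣uniformPart∣≡∣I∩R∣ I) ∣uniform∣≤r
  from : ∀ I → (∀ {x} → x ∈ I → x ∉ subset loop?) × ∣ I ∩ subset uniform? ∣ ≤ r → Indep M I
  from I (loopless , ∣I∩U∣≤r) = Equivalence.from (M⇔ I)
    ((Equivalence.from (∣loopPart∣≤0⇔loopless I) loopless , subst (_≤ r) (sym (∣uniformPart∣≡∣I∩R∣ I)) ∣I∩U∣≤r) ,
     ∣p∣≤n (drop (m + s) (relabel I)))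

classify : Subset n → Subset n → Fin n → Block
classify L R x with x ∈? L | x ∈? R
... | yes _ | _ = loopBlock
... | no _ | yes _ = uniformBlock
... | no _ | no _ = freeBlock

module _ {L R : Subset n} (L∩R≡∅ : ∀ {x} → x ∈ L → x ∉ R) where

  classify-loop : ∀ {x} → x ∈ L ⇔ classify L R x ≡ loopBlock
  classify-loop {x} with x ∈? L | x ∈? R
  ... | yes x∈L | _ = mk⇔ (λ _ → refl) (λ _ → x∈L)
  ... | no x∉L | yes _ = mk⇔ (⊥-elim ∘ x∉L) λ ()
  ... | no x∉L | no _ = mk⇔ (⊥-elim ∘ x∉L) λ ()

  classify-uniform : ∀ {x} → x ∈ R ⇔ classify L R x ≡ uniformBlock
  classify-uniform {x} with x ∈? L | x ∈? R
  ... | yes x∈L | _ = mk⇔ (⊥-elim ∘ L∩R≡∅ x∈L) λ ()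
  ... | no _ | yes x∈R = mk⇔ (λ _ → refl) (λ _ → x∈R)
  ... | no _ | no x∉R = mk⇔ (⊥-elim ∘ x∉R) λ ()

standardForm⇒≅ : ∀ {M : Matroid n} → StandardForm M →
                 Σ ℕ λ m → Σ ℕ λ r → Σ ℕ λ s → Σ ℕ λ l → r ≤ s × M ≅ ((U 0 m ⊕ U r s) ⊕ U l l)
standardForm⇒≅ {n} {M} sf with sort n (classify (StandardForm.loops sf) (StandardForm.uniform sf))
... | (a , b , c) , e , e-block = a , rank ⊓ b , b , c , m⊓n≤n rank b , e , λ I → mk⇔ (to I) (from I)
  where
  open StandardForm sf
  via-classify : ∀ {x k} {A : Set} → A ⇔ classify loops uniform x ≡ k →
                 block (a , b , c) (Inverse.to e x) ≡ classify loops uniform x →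
                 A ⇔ block (a , b , c) (Inverse.to e x) ≡ k
  via-classify A⇔ block≡ = mk⇔ (trans block≡ ∘ Equivalence.to A⇔) (Equivalence.from A⇔ ∘ trans (sym block≡))
  open BlockCounting e loops uniform
    (λ {x} → via-classify (classify-loop loop∉uniform) (e-block x))
    (λ {x} → via-classify (classify-uniform loop∉uniform) (e-block x))
  to : ∀ I → Indep M I → ((U 0 a ⊕ U (rank ⊓ b) b) ⊕ U c c) (relabel I)
  to I iI with Equivalence.to (indep⇔ I) iI
  ... | loopless , ∣I∩U∣≤rank =
        (Equivalence.from (∣loopPart∣≤0⇔loopless I) loopless ,
         ⊓-glb (subst (_≤ rank) (sym (∣uniformPart∣≡∣I∩R∣ I)) ∣I∩U∣≤rank) (∣p∣≤n (uniformPart I))) ,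
        ∣p∣≤n (drop (a + b) (relabel I))
  from : ∀ I → ((U 0 a ⊕ U (rank ⊓ b) b) ⊕ U c c) (relabel I) → Indep M I
  from I ((∣loops∣≤0 , ∣uniform∣≤) , _) = Equivalence.from (indep⇔ I)
    (Equivalence.to (∣loopPart∣≤0⇔loopless I) ∣loops∣≤0 ,
     subst (_≤ rank) (∣uniformPart∣≡∣I∩R∣ I) (≤-trans ∣uniform∣≤ (m⊓n≤m rank b)))

-- Matroids in standard form have neither minor

module CountingMinor {M : Matroid n} (sf : StandardForm M) {P : Subset k → Set}
  (f : Fin k → Fin n) (f-inj : Injective _≡_ _≡_ f) (B : Subset n) (f∉B : ∀ i → f i ∉ B)
  (iB : Indep M B) (P⇔ : ∀ I → P I ⇔ Indep M (image f I ∪ B)) (P? : ∀ I → Dec (P I))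
  (P⁅⁆ : ∀ i → P ⁅ i ⁆) where

  open StandardForm sf

  κ : Subset k → ℕ
  κ I = ∣ (image f I ∪ B) ∩ uniform ∣

  loopless : ∀ I {x} → x ∈ image f I ∪ B → x ∉ loops
  loopless I h with x∈p∪q⁻ (image f I) B h
  ... | inj₂ x∈B = proj₁ (Equivalence.to (indep⇔ B) iB) x∈B
  ... | inj₁ x∈fI with ∈image⁻ f {I} x∈fI
  ...   | j , _ , refl =
          proj₁ (Equivalence.to (indep⇔ _) (Equivalence.to (P⇔ ⁅ j ⁆) (P⁅⁆ j)))
                (x∈p∪q⁺ (inj₁ (∈image⁺ f (x∈⁅x⁆ j))))

  P⇒κ≤rank : ∀ I → {True (P? I)} → κ I ≤ rank
  P⇒κ≤rank I {PI} = proj₂ (Equivalence.to (indep⇔ _) (Equivalence.to (P⇔ I) (toWitness PI)))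

  ¬P⇒rank<κ : ∀ I → {False (P? I)} → rank < κ I
  ¬P⇒rank<κ I {¬PI} = ≰⇒> λ κI≤rank →
    toWitnessFalse ¬PI (Equivalence.from (P⇔ I) (Equivalence.from (indep⇔ _) (loopless I , κI≤rank)))

  κ-+ₛ-uniform : ∀ I i → i ∉ I → f i ∈ uniform → κ (I +ₛ i) ≡ suc (κ I)
  κ-+ₛ-uniform I i i∉I fi∈U = trans (cong (∣_∣ ∘ (_∩ uniform)) (image-+ₛ f I i B))
                                        (∣p+ₛx∩q∣≡1+∣p∩q∣ (f∉image-∪ f f-inj f∉B i∉I) fi∈U)

  κ-+ₛ-other : ∀ I i → f i ∉ uniform → κ (I +ₛ i) ≡ κ I
  κ-+ₛ-other I i fi∉U = cong ∣_∣ (trans (cong (_∩ uniform) (image-+ₛ f I i B)) (p+ₛx∩q≡p∩q fi∉U))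

  κ-+ₛ-≤ : ∀ I i → i ∉ I → κ (I +ₛ i) ≤ suc (κ I)
  κ-+ₛ-≤ I i i∉I with f i ∈? uniform
  ... | yes fi∈U = ≤-reflexive (κ-+ₛ-uniform I i i∉I fi∈U)
  ... | no fi∉U = ≤-trans (≤-reflexive (κ-+ₛ-other I i fi∉U)) (n≤1+n _)

module _ {M : Matroid n} (sf : StandardForm M) where
  open StandardForm sf
  open ≤-Reasoning

  standardForm⇒¬T24 : ¬ HasMinor M T24
  standardForm⇒¬T24 (f , f-inj , _ , f∉C , B , (B⊆C , iB , _) , T24⇔) = rank<rank
    where
    open CountingMinor sf f f-inj B (λ i → f∉C i ∘ B⊆C) iB T24⇔ T24? (from-yes (all? (T24? ∘ ⁅_⁆)))
    rank<rank : Empty.⊥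
    rank<rank with f 0F ∈? uniform
    ... | no f0∉U = <-irrefl refl $ begin-strict
      rank                    <⟨ ¬P⇒rank<κ (⁅ 1F ⁆ +ₛ 2F +ₛ 0F) ⟩
      κ (⁅ 1F ⁆ +ₛ 2F +ₛ 0F)  ≡⟨ κ-+ₛ-other (⁅ 1F ⁆ +ₛ 2F) 0F f0∉U ⟩
      κ (⁅ 1F ⁆ +ₛ 2F)        ≤⟨ P⇒κ≤rank (⁅ 1F ⁆ +ₛ 2F) ⟩
      rank                    ∎
    ... | yes f0∈U = <-irrefl refl $ begin-strict
      rank              <⟨ ¬P⇒rank<κ (⁅ 2F ⁆ +ₛ 3F) ⟩
      κ (⁅ 2F ⁆ +ₛ 3F)  ≤⟨ κ-+ₛ-≤ ⁅ 2F ⁆ 3F (from-no (3F ∈? ⁅ 2F ⁆)) ⟩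
      suc (κ ⁅ 2F ⁆)    ≡⟨ κ-+ₛ-uniform ⁅ 2F ⁆ 0F (from-no (0F ∈? ⁅ 2F ⁆)) f0∈U ⟨
      κ (⁅ 2F ⁆ +ₛ 0F)  ≤⟨ P⇒κ≤rank (⁅ 2F ⁆ +ₛ 0F) ⟩
      rank              ∎

  standardForm⇒¬U12⊕U12 : ¬ HasMinor M (U 1 2 ⊕ U 1 2)
  standardForm⇒¬U12⊕U12 (f , f-inj , _ , f∉C , B , (B⊆C , iB , _) , U⇔) = rank<rank
    where
    open CountingMinor sf f f-inj B (λ i → f∉C i ∘ B⊆C) iB U⇔ U12⊕U12?
                       (from-yes (all? (U12⊕U12? ∘ ⁅_⁆)))
    rank<rank : Empty.⊥
    rank<rank with f 2F ∈? uniform | f 0F ∈? uniform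
    ... | yes f2∈U | _ = <-irrefl refl $ begin-strict
      rank              <⟨ ¬P⇒rank<κ (⁅ 0F ⁆ +ₛ 1F) ⟩
      κ (⁅ 0F ⁆ +ₛ 1F)  ≤⟨ κ-+ₛ-≤ ⁅ 0F ⁆ 1F (from-no (1F ∈? ⁅ 0F ⁆)) ⟩
      suc (κ ⁅ 0F ⁆)    ≡⟨ κ-+ₛ-uniform ⁅ 0F ⁆ 2F (from-no (2F ∈? ⁅ 0F ⁆)) f2∈U ⟨
      κ (⁅ 0F ⁆ +ₛ 2F)  ≤⟨ P⇒κ≤rank (⁅ 0F ⁆ +ₛ 2F) ⟩
      rank              ∎
    ... | no _ | yes f0∈U = <-irrefl refl $ begin-strict
      rank              <⟨ ¬P⇒rank<κ (⁅ 2F ⁆ +ₛ 3F) ⟩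
      κ (⁅ 2F ⁆ +ₛ 3F)  ≤⟨ κ-+ₛ-≤ ⁅ 2F ⁆ 3F (from-no (3F ∈? ⁅ 2F ⁆)) ⟩
      suc (κ ⁅ 2F ⁆)    ≡⟨ κ-+ₛ-uniform ⁅ 2F ⁆ 0F (from-no (0F ∈? ⁅ 2F ⁆)) f0∈U ⟨
      κ (⁅ 2F ⁆ +ₛ 0F)  ≤⟨ P⇒κ≤rank (⁅ 2F ⁆ +ₛ 0F) ⟩
      rank              ∎
    ... | no f2∉U | no f0∉U = <-irrefl refl $ begin-strict
      rank              <⟨ ¬P⇒rank<κ (⁅ 3F ⁆ +ₛ 2F) ⟩
      κ (⁅ 3F ⁆ +ₛ 2F)  ≡⟨ κ-+ₛ-other ⁅ 3F ⁆ 2F f2∉U ⟩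
      κ ⁅ 3F ⁆          ≡⟨ κ-+ₛ-other ⁅ 3F ⁆ 0F f0∉U ⟨
      κ (⁅ 3F ⁆ +ₛ 0F)  ≤⟨ P⇒κ≤rank (⁅ 3F ⁆ +ₛ 0F) ⟩
      rank              ∎

-- Matroids without these minors have standard form

module FourPointMinor (M : Matroid n) (C : Subset n) (iC : Indep M C)
  (f : Fin 4 → Fin n) (f-inj : Injective _≡_ _≡_ f) (f∉C : ∀ i → f i ∉ C) where

  Pair : Fin 4 → Fin 4 → Set
  Pair i j = Indep M (C +ₛ f i +ₛ f j)

  Triple : Fin 4 → Fin 4 → Fin 4 → Set
  Triple i j k = Indep M (C +ₛ f i +ₛ f j +ₛ f k)

  private
    f∈ : ∀ {I i} → True (i ∈? I) → f i ∈ image f I ∪ C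
    f∈ i∈I = x∈p∪q⁺ (inj₁ (∈image⁺ f (toWitness i∈I)))

    C⊆ : ∀ {I} → C ⊆ image f I ∪ C
    C⊆ {I} = q⊆p∪q (image f I) C

  pair⇒indep : ∀ I i j → {True (I ⊆? ⁅ i ⁆ +ₛ j)} → Pair i j → Indep M (image f I ∪ C)
  pair⇒indep I i j {I⊆ij} = indep-down M (image-∪-⊆ f (p⊆p+ₛx ∘ p⊆p+ₛx) fI⊆)
    where
    fI⊆ : ∀ {k} → k ∈ I → f k ∈ C +ₛ f i +ₛ f j
    fI⊆ k∈I with y∈p+ₛx⁻ (toWitness I⊆ij k∈I)
    ... | inj₂ refl = x∈p+ₛx
    ... | inj₁ k∈i rewrite x∈⁅y⁆⇒x≡y i k∈i = p⊆p+ₛx x∈p+ₛx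

  ¬pair⇒dep : ∀ I i j → {True (i ∈? I)} → {True (j ∈? I)} → ¬ Pair i j → ¬ Indep M (image f I ∪ C)
  ¬pair⇒dep I i j {i∈I} {j∈I} ¬ij = ¬ij ∘ indep-down M (+ₛ-⊆ (+ₛ-⊆ (C⊆ {I}) (f∈ i∈I)) (f∈ j∈I))

  ¬triple⇒dep : ∀ I i j k → {True (i ∈? I)} → {True (j ∈? I)} → {True (k ∈? I)} →
                ¬ Triple i j k → ¬ Indep M (image f I ∪ C)
  ¬triple⇒dep I i j k {i∈I} {j∈I} {k∈I} ¬ijk =
    ¬ijk ∘ indep-down M (+ₛ-⊆ (+ₛ-⊆ (+ₛ-⊆ (C⊆ {I}) (f∈ i∈I)) (f∈ j∈I)) (f∈ k∈I))

  module _ {P : Subset 4 → Set} (P? : ∀ I → Dec (P I)) where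

    agrees-indep : ∀ I → {True (P? I)} → Indep M (image f I ∪ C) → P I ⇔ Indep M (image f I ∪ C)
    agrees-indep I {PI} iI = mk⇔ (λ _ → iI) (λ _ → toWitness PI)

    agrees-dep : ∀ I → {False (P? I)} → ¬ Indep M (image f I ∪ C) → P I ⇔ Indep M (image f I ∪ C)
    agrees-dep I {¬PI} ¬iI = mk⇔ (⊥-elim ∘ toWitnessFalse ¬PI) (⊥-elim ∘ ¬iI)

    -- C is contracted (it is its own basis) and everything outside C ∪ image f is deleted.
    minor : (∀ I → P I ⇔ Indep M (image f I ∪ C)) → HasMinor M P
    minor P⇔ = f , f-inj , C , f∉C , C , (id , iC , λ _ x∈C x∉C → ⊥-elim (x∉C x∈C)) , P⇔

  T24-minor : Pair 0F 1F → Pair 0F 2F → Pair 0F 3F → Pair 1F 2F → Pair 1F 3F → ¬ Pair 2F 3F →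
              ¬ Triple 0F 1F 2F → ¬ Triple 0F 1F 3F → ¬ Triple 0F 2F 3F → ¬ Triple 1F 2F 3F →
              HasMinor M T24
  T24-minor p01 p02 p03 p12 p13 ¬p23 ¬t012 ¬t013 ¬t023 ¬t123 = minor T24? T24⇔
    where
    indep : ∀ I → {True (T24? I)} → Indep M (image f I ∪ C) → T24 I ⇔ Indep M (image f I ∪ C)
    indep = agrees-indep T24?
    dep : ∀ I → {False (T24? I)} → ¬ Indep M (image f I ∪ C) → T24 I ⇔ Indep M (image f I ∪ C)
    dep = agrees-dep T24?
    T24⇔ : ∀ I → T24 I ⇔ Indep M (image f I ∪ C)
    T24⇔ I@(false ∷ false ∷ false ∷ false ∷ []) = indep I (pair⇒indep I 0F 1F p01)
    T24⇔ I@(true  ∷ false ∷ false ∷ false ∷ []) = indep I (pair⇒indep I 0F 1F p01)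
    T24⇔ I@(false ∷ true  ∷ false ∷ false ∷ []) = indep I (pair⇒indep I 0F 1F p01)
    T24⇔ I@(false ∷ false ∷ true  ∷ false ∷ []) = indep I (pair⇒indep I 0F 2F p02)
    T24⇔ I@(false ∷ false ∷ false ∷ true  ∷ []) = indep I (pair⇒indep I 0F 3F p03)
    T24⇔ I@(true  ∷ true  ∷ false ∷ false ∷ []) = indep I (pair⇒indep I 0F 1F p01)
    T24⇔ I@(true  ∷ false ∷ true  ∷ false ∷ []) = indep I (pair⇒indep I 0F 2F p02)
    T24⇔ I@(true  ∷ false ∷ false ∷ true  ∷ []) = indep I (pair⇒indep I 0F 3F p03)
    T24⇔ I@(false ∷ true  ∷ true  ∷ false ∷ []) = indep I (pair⇒indep I 1F 2F p12)
    T24⇔ I@(false ∷ true  ∷ false ∷ true  ∷ []) = indep I (pair⇒indep I 1F 3F p13)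
    T24⇔ I@(false ∷ false ∷ true  ∷ true  ∷ []) = dep I (¬pair⇒dep I 2F 3F ¬p23)
    T24⇔ I@(true  ∷ true  ∷ true  ∷ false ∷ []) = dep I (¬triple⇒dep I 0F 1F 2F ¬t012)
    T24⇔ I@(true  ∷ true  ∷ false ∷ true  ∷ []) = dep I (¬triple⇒dep I 0F 1F 3F ¬t013)
    T24⇔ I@(true  ∷ false ∷ true  ∷ true  ∷ []) = dep I (¬triple⇒dep I 0F 2F 3F ¬t023)
    T24⇔ I@(false ∷ true  ∷ true  ∷ true  ∷ []) = dep I (¬triple⇒dep I 1F 2F 3F ¬t123)
    T24⇔ I@(true  ∷ true  ∷ true  ∷ true  ∷ []) = dep I (¬triple⇒dep I 0F 1F 2F ¬t012)

  U12⊕U12-minor : Pair 0F 2F → Pair 0F 3F → Pair 1F 2F → Pair 1F 3F → ¬ Pair 0F 1F → ¬ Pair 2F 3F →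
                  ¬ Triple 0F 1F 2F → ¬ Triple 0F 1F 3F → ¬ Triple 0F 2F 3F → ¬ Triple 1F 2F 3F →
                  HasMinor M (U 1 2 ⊕ U 1 2)
  U12⊕U12-minor p02 p03 p12 p13 ¬p01 ¬p23 ¬t012 ¬t013 ¬t023 ¬t123 = minor U12⊕U12? U⇔
    where
    indep : ∀ I → {True (U12⊕U12? I)} → Indep M (image f I ∪ C) → (U 1 2 ⊕ U 1 2) I ⇔ Indep M (image f I ∪ C)
    indep = agrees-indep U12⊕U12?
    dep : ∀ I → {False (U12⊕U12? I)} → ¬ Indep M (image f I ∪ C) → (U 1 2 ⊕ U 1 2) I ⇔ Indep M (image f I ∪ C)
    dep = agrees-dep U12⊕U12?
    U⇔ : ∀ I → (U 1 2 ⊕ U 1 2) I ⇔ Indep M (image f I ∪ C)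
    U⇔ I@(false ∷ false ∷ false ∷ false ∷ []) = indep I (pair⇒indep I 0F 2F p02)
    U⇔ I@(true  ∷ false ∷ false ∷ false ∷ []) = indep I (pair⇒indep I 0F 2F p02)
    U⇔ I@(false ∷ true  ∷ false ∷ false ∷ []) = indep I (pair⇒indep I 1F 2F p12)
    U⇔ I@(false ∷ false ∷ true  ∷ false ∷ []) = indep I (pair⇒indep I 0F 2F p02)
    U⇔ I@(false ∷ false ∷ false ∷ true  ∷ []) = indep I (pair⇒indep I 0F 3F p03)
    U⇔ I@(true  ∷ true  ∷ false ∷ false ∷ []) = dep I (¬pair⇒dep I 0F 1F ¬p01)
    U⇔ I@(true  ∷ false ∷ true  ∷ false ∷ []) = indep I (pair⇒indep I 0F 2F p02)
    U⇔ I@(true  ∷ false ∷ false ∷ true  ∷ []) = indep I (pair⇒indep I 0F 3F p03)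
    U⇔ I@(false ∷ true  ∷ true  ∷ false ∷ []) = indep I (pair⇒indep I 1F 2F p12)
    U⇔ I@(false ∷ true  ∷ false ∷ true  ∷ []) = indep I (pair⇒indep I 1F 3F p13)
    U⇔ I@(false ∷ false ∷ true  ∷ true  ∷ []) = dep I (¬pair⇒dep I 2F 3F ¬p23)
    U⇔ I@(true  ∷ true  ∷ true  ∷ false ∷ []) = dep I (¬triple⇒dep I 0F 1F 2F ¬t012)
    U⇔ I@(true  ∷ true  ∷ false ∷ true  ∷ []) = dep I (¬triple⇒dep I 0F 1F 3F ¬t013)
    U⇔ I@(true  ∷ false ∷ true  ∷ true  ∷ []) = dep I (¬triple⇒dep I 0F 2F 3F ¬t023)
    U⇔ I@(false ∷ true  ∷ true  ∷ true  ∷ []) = dep I (¬triple⇒dep I 1F 2F 3F ¬t123)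
    U⇔ I@(true  ∷ true  ∷ true  ∷ true  ∷ []) = dep I (¬triple⇒dep I 0F 1F 2F ¬t012)

module _ {a b c d : Fin n} where

  lookup₄-injective : a ≢ b → a ≢ c → a ≢ d → b ≢ c → b ≢ d → c ≢ d →
                      Injective _≡_ _≡_ (lookup (a ∷ b ∷ c ∷ d ∷ []))
  lookup₄-injective a≢b a≢c a≢d b≢c b≢d c≢d {i} {j} =
    lookup-injective ((a≢b ∷ a≢c ∷ a≢d ∷ []) ∷ (b≢c ∷ b≢d ∷ []) ∷ (c≢d ∷ []) ∷ [] ∷ []) i j

  lookup₄-∉ : ∀ {K : Subset n} → a ∉ K → b ∉ K → c ∉ K → d ∉ K → ∀ i → lookup (a ∷ b ∷ c ∷ d ∷ []) i ∉ K
  lookup₄-∉ {K} a∉K b∉K c∉K d∉K = lookup⁺ {P = _∉ K} (a∉K ∷ b∉K ∷ c∉K ∷ d∉K ∷ [])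

module WithoutMinors (M : Matroid n) (¬T24 : ¬ HasMinor M T24) (¬U : ¬ HasMinor M (U 1 2 ⊕ U 1 2)) where

  loop? : ∀ x → Dec (¬ Indep M ⁅ x ⁆)
  loop? = ¬? ∘ indep? M ∘ ⁅_⁆

  uniform? : ∀ x → Dec (Indep M ⁅ x ⁆ × ¬ Coloop M x)
  uniform? x = indep? M ⁅ x ⁆ ×-dec ¬? (coloop? M x)

  loops uniform : Subset n
  loops = subset loop?
  uniform = subset uniform?

  B₀ : Subset n
  B₀ = proj₁ (max-indep-subset M uniform)

  B₀⊆uniform : B₀ ⊆ uniform
  B₀⊆uniform = proj₁ (proj₂ (max-indep-subset M uniform))

  iB₀ : Indep M B₀
  iB₀ = proj₁ (proj₂ (proj₂ (max-indep-subset M uniform)))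

  r : ℕ
  r = ∣ B₀ ∣

  ∣J∣≤r : ∀ J → J ⊆ uniform → Indep M J → ∣ J ∣ ≤ r
  ∣J∣≤r = proj₂ (proj₂ (proj₂ (max-indep-subset M uniform)))

  ∉uniform⇒coloop : ∀ {J x} → Indep M J → x ∈ J → x ∉ uniform → Coloop M x
  ∉uniform⇒coloop {J} {x} iJ x∈J x∉U with coloop? M x
  ... | yes col = col
  ... | no ¬col = ⊥-elim (x∉U (∈subset⁺ uniform? (indep-down M (⁅x⁆⊆p x∈J) iJ , ¬col)))

  module Configuration (D : Subset n) (D⊆U : D ⊆ uniform) (circ : IsCircuit M D)
    {x y z : Fin n} (x∈D : x ∈ D) (y∈D : y ∈ D) (x≢y : x ≢ y) (z∈U : z ∈ uniform) (z∉D : z ∉ D)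
    (B₁ : Subset n) (D-y⊆B₁ : D - y ⊆ B₁) (z∈B₁ : z ∈ B₁) (B₁⊆U : B₁ ⊆ uniform)
    (iB₁ : Indep M B₁) (∣B₁∣≡r : ∣ B₁ ∣ ≡ r) where

    ¬iD : ¬ Indep M D
    ¬iD = proj₁ circ

    x∈B₁ : x ∈ B₁
    x∈B₁ = D-y⊆B₁ (x∈p∧x≢y⇒x∈p-y x∈D x≢y)

    z≢x : z ≢ x
    z≢x refl = z∉D x∈D

    z≢y : z ≢ y
    z≢y refl = z∉D y∈D

    y∉B₁ : y ∉ B₁
    y∉B₁ y∈B₁ = ¬iD (indep-down M (+ₛ-⊆ D-y⊆B₁ y∈B₁ ∘ p⊆p-x+ₛx y∈D) iB₁)

    K : Subset n
    K = B₁ - x - z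

    K⊆B₁ : K ⊆ B₁
    K⊆B₁ = proj₁ ∘ x∈p-y⁻ ∘ proj₁ ∘ x∈p-y⁻

    K⊆U : K ⊆ uniform
    K⊆U = B₁⊆U ∘ K⊆B₁

    x∉K : x ∉ K
    x∉K h = proj₂ (x∈p-y⁻ (proj₁ (x∈p-y⁻ h))) refl

    z∉K : z ∉ K
    z∉K h = proj₂ (x∈p-y⁻ h) refl

    y∉K : y ∉ K
    y∉K = y∉B₁ ∘ K⊆B₁

    r≡2+∣K∣ : r ≡ suc (suc ∣ K ∣)
    r≡2+∣K∣ = trans (sym ∣B₁∣≡r)
                (trans (∣p∣≡1+∣p-x∣ x∈B₁) (cong suc (∣p∣≡1+∣p-x∣ (x∈p∧x≢y⇒x∈p-y z∈B₁ z≢x))))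

    iK+x+z : Indep M (K +ₛ x +ₛ z)
    iK+x+z = indep-down M (+ₛ-⊆ (+ₛ-⊆ K⊆B₁ x∈B₁) z∈B₁) iB₁

    D⊆K+x+y : D ⊆ K +ₛ x +ₛ y
    D⊆K+x+y {e} e∈D with e ≟ y | e ≟ x
    ... | yes refl | _ = x∈p+ₛx
    ... | no _ | yes refl = p⊆p+ₛx x∈p+ₛx
    ... | no e≢y | no e≢x = p⊆p+ₛx (p⊆p+ₛx (x∈p∧x≢y⇒x∈p-y (x∈p∧x≢y⇒x∈p-y e∈B₁ e≢x) e≢z))
      where
      e∈B₁ : e ∈ B₁
      e∈B₁ = D-y⊆B₁ (x∈p∧x≢y⇒x∈p-y e∈D e≢y)
      e≢z : e ≢ z
      e≢z refl = z∉D e∈D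

    ¬iK+x+y : ¬ Indep M (K +ₛ x +ₛ y)
    ¬iK+x+y = ¬iD ∘ indep-down M D⊆K+x+y

    D-x⊆K+y : D - x ⊆ K +ₛ y
    D-x⊆K+y h with x∈p-y⁻ h
    ... | e∈D , e≢x with y∈p+ₛx⁻ (D⊆K+x+y e∈D)
    ...   | inj₂ refl = x∈p+ₛx
    ...   | inj₁ e∈K+x with y∈p+ₛx⁻ e∈K+x
    ...     | inj₁ e∈K = p⊆p+ₛx e∈K
    ...     | inj₂ e≡x = ⊥-elim (e≢x e≡x)

    ∣K+a+b∣≡r : ∀ {a b} → a ∉ K → b ∉ K → b ≢ a → ∣ K +ₛ a +ₛ b ∣ ≡ r
    ∣K+a+b∣≡r a∉K b∉K b≢a =
      trans (∣p+ₛx∣≡1+∣p∣ (∉+ₛ b∉K b≢a)) (trans (cong suc (∣p+ₛx∣≡1+∣p∣ a∉K)) (sym r≡2+∣K∣))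

    triple-dependent : ∀ {a b c} → a ∈ uniform → b ∈ uniform → c ∈ uniform → a ∉ K → b ∉ K → c ∉ K →
                       b ≢ a → c ≢ a → c ≢ b → ¬ Indep M (K +ₛ a +ₛ b +ₛ c)
    triple-dependent {a} {b} {c} a∈U b∈U c∈U a∉K b∉K c∉K b≢a c≢a c≢b i =
      1+n≰n (subst (_≤ r) ∣K+a+b+c∣≡1+r (∣J∣≤r _ (+ₛ-⊆ (+ₛ-⊆ (+ₛ-⊆ K⊆U a∈U) b∈U) c∈U) i))
      where
      ∣K+a+b+c∣≡1+r : ∣ K +ₛ a +ₛ b +ₛ c ∣ ≡ suc r
      ∣K+a+b+c∣≡1+r = trans (∣p+ₛx∣≡1+∣p∣ (∉+ₛ (∉+ₛ c∉K c≢a) c≢b)) (cong suc (∣K+a+b∣≡r a∉K b∉K b≢a))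

    -- Circuit exchange: D - x is independent and spans x, so it can replace x.
    exchange : ∀ {u} → u ∉ K → u ≢ x → u ≢ y → Indep M (K +ₛ x +ₛ u) → Indep M (K +ₛ u +ₛ y)
    exchange {u} u∉K u≢x u≢y iK+x+u with augment M (proj₂ circ x∈D) iK+x+u
    ... | I , D-x⊆I , I⊆ , iI , r≤∣I∣ = indep-down M (⊆∧∣≥∣⇒⊇ I⊆K+u+y ∣K+u+y∣≤∣I∣) iI
      where
      x∉I : x ∉ I
      x∉I x∈I = ¬iD (indep-down M (+ₛ-⊆ D-x⊆I x∈I ∘ p⊆p-x+ₛx x∈D) iI)
      I⊆K+u+y : I ⊆ K +ₛ u +ₛ y
      I⊆K+u+y e∈I with x∈p∪q⁻ (D - x) (K +ₛ x +ₛ u) (I⊆ e∈I)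
      ... | inj₁ e∈D-x with y∈p+ₛx⁻ (D-x⊆K+y e∈D-x)
      ...   | inj₁ e∈K = p⊆p+ₛx (p⊆p+ₛx e∈K)
      ...   | inj₂ refl = x∈p+ₛx
      I⊆K+u+y e∈I | inj₂ e∈K+x+u with y∈p+ₛx⁻ e∈K+x+u
      ...   | inj₂ refl = p⊆p+ₛx x∈p+ₛx
      ...   | inj₁ e∈K+x with y∈p+ₛx⁻ e∈K+x
      ...     | inj₁ e∈K = p⊆p+ₛx (p⊆p+ₛx e∈K)
      ...     | inj₂ refl = ⊥-elim (x∉I e∈I)
      ∣K+u+y∣≤∣I∣ : ∣ K +ₛ u +ₛ y ∣ ≤ ∣ I ∣
      ∣K+u+y∣≤∣I∣ = ≤-trans (≤-reflexive (trans (∣K+a+b∣≡r u∉K y∉K (≢-sym u≢y))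
                                               (sym (∣K+a+b∣≡r x∉K u∉K u≢x)))) r≤∣I∣

    Candidate : Fin n → Set
    Candidate w = w ∈ uniform × w ∉ K × w ≢ x × w ≢ z × Indep M (K +ₛ x +ₛ w)

    candidate? : ∀ w → Dec (Candidate w)
    candidate? w = (w ∈? uniform) ×-dec (¬? (w ∈? K) ×-dec (¬? (w ≟ x) ×-dec (¬? (w ≟ z) ×-dec indep? M _)))

    ¬candidate⇒coloop : (∀ w → ¬ Candidate w) → Coloop M z
    ¬candidate⇒coloop ∄w J iJ with augment M (indep-down M (p∩q⊆p J uniform) iJ) iB₁
    ... | I , J∩U⊆I , I⊆ , iI , ∣B₁∣≤∣I∣ with z ∈? I
    ...   | no z∉I = ⊥-elim (1+n≰n (≤-trans 2+∣K∣≤∣I∣ ∣I∣≤1+∣K∣))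
      where
      2+∣K∣≤∣I∣ : suc (suc ∣ K ∣) ≤ ∣ I ∣
      2+∣K∣≤∣I∣ = subst (_≤ ∣ I ∣) (trans ∣B₁∣≡r r≡2+∣K∣) ∣B₁∣≤∣I∣
      I⊆U : I ⊆ uniform
      I⊆U e∈I with x∈p∪q⁻ (J ∩ uniform) B₁ (I⊆ e∈I)
      ... | inj₁ e∈J∩U = p∩q⊆q J uniform e∈J∩U
      ... | inj₂ e∈B₁ = B₁⊆U e∈B₁
      spanned : ∀ {e} → e ∈ I → e ∈ K +ₛ x ⊎ ¬ Indep M (K +ₛ x +ₛ e)
      spanned {e} e∈I with e ∈? K +ₛ x
      ... | yes e∈K+x = inj₁ e∈K+x
      ... | no e∉K+x = inj₂ λ iK+x+e →
            ∄w e (I⊆U e∈I , e∉K+x ∘ p⊆p+ₛx , (λ { refl → e∉K+x x∈p+ₛx }) , (λ { refl → z∉I e∈I }) , iK+x+e)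
      ∣I∣≤1+∣K∣ : ∣ I ∣ ≤ suc ∣ K ∣
      ∣I∣≤1+∣K∣ = subst (∣ I ∣ ≤_) (∣p+ₛx∣≡1+∣p∣ x∉K)
                    (maximal⇒∣J∣≤∣A∣ M (indep-down M p⊆p+ₛx iK+x+z) iI spanned)
    ...   | yes z∈I = indep-down M J+z⊆ (indep-∪-coloops M J _ (indep-down M (+ₛ-⊆ J∩U⊆I z∈I) iI) J⊆)
      where
      J⊆ : ∀ {e} → e ∈ J → e ∈ (J ∩ uniform) +ₛ z ⊎ Coloop M e
      J⊆ {e} e∈J with e ∈? uniform
      ... | yes e∈U = inj₁ (p⊆p+ₛx (x∈p∩q⁺ (e∈J , e∈U)))
      ... | no e∉U = inj₂ (∉uniform⇒coloop iJ e∈J e∉U)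
      J+z⊆ : J +ₛ z ⊆ ((J ∩ uniform) +ₛ z) ∪ J
      J+z⊆ h with y∈p+ₛx⁻ h
      ... | inj₁ e∈J = x∈p∪q⁺ (inj₂ e∈J)
      ... | inj₂ refl = x∈p∪q⁺ (inj₁ x∈p+ₛx)

    candidate⇒minor : ∀ {w} → Candidate w → HasMinor M T24 ⊎ HasMinor M (U 1 2 ⊕ U 1 2)
    candidate⇒minor {w} (w∈U , w∉K , w≢x , w≢z , iK+x+w) = minor (indep? M (K +ₛ z +ₛ w))
      where
      x∈U : x ∈ uniform
      x∈U = D⊆U x∈D
      y∈U : y ∈ uniform
      y∈U = D⊆U y∈D
      iK : Indep M K
      iK = indep-down M K⊆B₁ iB₁
      w≢y : w ≢ y
      w≢y refl = ¬iK+x+y iK+x+w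
      iK+z+y : Indep M (K +ₛ z +ₛ y)
      iK+z+y = exchange z∉K z≢x z≢y iK+x+z
      iK+w+y : Indep M (K +ₛ w +ₛ y)
      iK+w+y = exchange w∉K w≢x w≢y iK+x+w
      minor : Dec (Indep M (K +ₛ z +ₛ w)) → HasMinor M T24 ⊎ HasMinor M (U 1 2 ⊕ U 1 2)
      minor (yes iK+z+w) = inj₁ (FourPointMinor.T24-minor M K iK (lookup (z ∷ w ∷ x ∷ y ∷ []))
            (lookup₄-injective (≢-sym w≢z) z≢x z≢y w≢x w≢y x≢y) (lookup₄-∉ z∉K w∉K x∉K y∉K)
            iK+z+w (indep-down M +ₛ-comm iK+x+z) iK+z+y (indep-down M +ₛ-comm iK+x+w) iK+w+y ¬iK+x+y
            (triple-dependent z∈U w∈U x∈U z∉K w∉K x∉K w≢z (≢-sym z≢x) (≢-sym w≢x))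
            (triple-dependent z∈U w∈U y∈U z∉K w∉K y∉K w≢z (≢-sym z≢y) (≢-sym w≢y))
            (triple-dependent z∈U x∈U y∈U z∉K x∉K y∉K (≢-sym z≢x) (≢-sym z≢y) (≢-sym x≢y))
            (triple-dependent w∈U x∈U y∈U w∉K x∉K y∉K (≢-sym w≢x) (≢-sym w≢y) (≢-sym x≢y)))
      minor (no ¬iK+z+w) = inj₂ (FourPointMinor.U12⊕U12-minor M K iK (lookup (x ∷ y ∷ z ∷ w ∷ []))
            (lookup₄-injective x≢y (≢-sym z≢x) (≢-sym w≢x) (≢-sym z≢y) (≢-sym w≢y) (≢-sym w≢z))
            (lookup₄-∉ x∉K y∉K z∉K w∉K)
            iK+x+z iK+x+w (indep-down M +ₛ-comm iK+z+y) (indep-down M +ₛ-comm iK+w+y) ¬iK+x+y ¬iK+z+w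
            (triple-dependent x∈U y∈U z∈U x∉K y∉K z∉K (≢-sym x≢y) z≢x z≢y)
            (triple-dependent x∈U y∈U w∈U x∉K y∉K w∉K (≢-sym x≢y) w≢x w≢y)
            (triple-dependent x∈U z∈U w∈U x∉K z∉K w∉K z≢x w≢x w≢z)
            (triple-dependent y∈U z∈U w∈U y∉K z∉K w∉K z≢y w≢y w≢z))

    impossible : Empty.⊥
    impossible with any? candidate?
    ... | yes (_ , cw) = [ ¬T24 , ¬U ]′ (candidate⇒minor cw)
    ... | no ∄w = proj₂ (∈subset⁻ uniform? z∈U) (¬candidate⇒coloop λ w cw → ∄w (w , cw))

  circuit-has-two : ∀ {D} → D ⊆ uniform → IsCircuit M D → ∃ λ x → ∃ λ y → x ∈ D × y ∈ D × x ≢ y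
  circuit-has-two {D} D⊆U (¬iD , _) with nonempty⊎≡⊥ D
  ... | inj₂ refl = ⊥-elim (¬iD (indep-∅ M))
  ... | inj₁ (x , x∈D) with nonempty⊎≡⊥ (D - x)
  ...   | inj₁ (y , y∈D-x) = x , y , x∈D , proj₁ (x∈p-y⁻ y∈D-x) , ≢-sym (proj₂ (x∈p-y⁻ y∈D-x))
  ...   | inj₂ D-x≡⊥ = ⊥-elim (¬iD (indep-down M D⊆⁅x⁆ (proj₁ (∈subset⁻ uniform? (D⊆U x∈D)))))
    where
    D⊆⁅x⁆ : D ⊆ ⁅ x ⁆
    D⊆⁅x⁆ {e} e∈D with e ≟ x
    ... | yes refl = x∈⁅x⁆ x
    ... | no e≢x = ⊥-elim (∉⊥ (subst (e ∈_) D-x≡⊥ (x∈p∧x≢y⇒x∈p-y e∈D e≢x)))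

  basis-through : ∀ {D y} → D ⊆ uniform → IsCircuit M D → ∣ D ∣ ≤ r → y ∈ D →
                  ∃ λ z → z ∈ uniform × z ∉ D ×
                  ∃ λ B₁ → D - y ⊆ B₁ × z ∈ B₁ × B₁ ⊆ uniform × Indep M B₁ × ∣ B₁ ∣ ≡ r
  basis-through {D} {y} D⊆U (¬iD , iD∖) ∣D∣≤r y∈D
    with indep-aug M (iD∖ y∈D) iB₀ (subst (_≤ r) (∣p∣≡1+∣p-x∣ y∈D) ∣D∣≤r)
  ... | z , z∈B₀ , z∉D-y , iD-y+z with augment M iD-y+z iB₀
  ...   | B₁ , D-y+z⊆B₁ , B₁⊆ , iB₁ , r≤∣B₁∣ =
          z , B₀⊆uniform z∈B₀ , z∉D , B₁ , D-y+z⊆B₁ ∘ p⊆p+ₛx , D-y+z⊆B₁ x∈p+ₛx , B₁⊆U , iB₁ ,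
          ≤-antisym (∣J∣≤r B₁ B₁⊆U iB₁) r≤∣B₁∣
    where
    z∉D : z ∉ D
    z∉D z∈D with z ≟ y
    ... | yes refl = ¬iD (indep-down M (p⊆p-x+ₛx y∈D) iD-y+z)
    ... | no z≢y = z∉D-y (x∈p∧x≢y⇒x∈p-y z∈D z≢y)
    B₁⊆U : B₁ ⊆ uniform
    B₁⊆U e∈B₁ with x∈p∪q⁻ (D - y +ₛ z) B₀ (B₁⊆ e∈B₁)
    ... | inj₂ e∈B₀ = B₀⊆uniform e∈B₀
    ... | inj₁ e∈D-y+z with y∈p+ₛx⁻ e∈D-y+z
    ...   | inj₁ e∈D-y = D⊆U (proj₁ (x∈p-y⁻ e∈D-y))
    ...   | inj₂ refl = B₀⊆uniform z∈B₀

  no-small-circuit : ∀ D → D ⊆ uniform → IsCircuit M D → ∣ D ∣ ≤ r → Empty.⊥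
  no-small-circuit D D⊆U circ ∣D∣≤r with circuit-has-two D⊆U circ
  ... | x , y , x∈D , y∈D , x≢y with basis-through D⊆U circ ∣D∣≤r y∈D
  ...   | z , z∈U , z∉D , B₁ , D-y⊆B₁ , z∈B₁ , B₁⊆U , iB₁ , ∣B₁∣≡r =
          Configuration.impossible D D⊆U circ x∈D y∈D x≢y z∈U z∉D B₁ D-y⊆B₁ z∈B₁ B₁⊆U iB₁ ∣B₁∣≡r

  small⇒indep : ∀ J → J ⊆ uniform → ∣ J ∣ ≤ r → Indep M J
  small⇒indep J J⊆U ∣J∣≤r with indep? M J
  ... | yes iJ = iJ
  ... | no ¬iJ with dependent⇒circuit M ¬iJ
  ...   | D , D⊆J , circ = ⊥-elim (no-small-circuit D (J⊆U ∘ D⊆J) circ (≤-trans (p⊆q⇒∣p∣≤∣q∣ D⊆J) ∣J∣≤r))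

  standardForm : StandardForm M
  standardForm = record
    { loops = loops ; uniform = uniform ; rank = r
    ; loop∉uniform = λ x∈L x∈U → ∈subset⁻ loop? x∈L (proj₁ (∈subset⁻ uniform? x∈U))
    ; indep⇔ = λ I → mk⇔ (to I) (from I)
    }
    where
    to : ∀ I → Indep M I → (∀ {x} → x ∈ I → x ∉ loops) × ∣ I ∩ uniform ∣ ≤ r
    to I iI = (λ x∈I x∈L → ∈subset⁻ loop? x∈L (indep-down M (⁅x⁆⊆p x∈I) iI)) ,
              ∣J∣≤r (I ∩ uniform) (p∩q⊆q I uniform) (indep-down M (p∩q⊆p I uniform) iI)
    from : ∀ I → (∀ {x} → x ∈ I → x ∉ loops) × ∣ I ∩ uniform ∣ ≤ r → Indep M I
    from I (loopless , ∣I∩U∣≤r) = indep-down M (q⊆p∪q (I ∩ uniform) I)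
      (indep-∪-coloops M I (I ∩ uniform) (small⇒indep _ (p∩q⊆q I uniform) ∣I∩U∣≤r) I⊆)
      where
      I⊆ : ∀ {e} → e ∈ I → e ∈ I ∩ uniform ⊎ Coloop M e
      I⊆ {e} e∈I with e ∈? uniform | coloop? M e
      ... | yes e∈U | _ = inj₁ (x∈p∩q⁺ (e∈I , e∈U))
      ... | no _ | yes col = inj₂ col
      ... | no e∉U | no ¬col = ⊥-elim (e∉U (∈subset⁺ uniform?
              (decidable-stable (indep? M ⁅ e ⁆) (loopless e∈I ∘ ∈subset⁺ loop?) , ¬col)))

proposition4p9 : ∀ {n} (M : Matroid n) →
    (Σ ℕ λ m → Σ ℕ λ r → Σ ℕ λ s → Σ ℕ λ l →
       r ≤ s × M ≅ ((U 0 m ⊕ U r s) ⊕ U l l))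
    ⇔ (¬ HasMinor M T24 × ¬ HasMinor M (U 1 2 ⊕ U 1 2))
proposition4p9 M = mk⇔
  (λ (m , r , s , l , _ , M≅) → let sf = ≅⇒standardForm {M = M} {m} {r} {s} {l} M≅ in
                                standardForm⇒¬T24 sf , standardForm⇒¬U12⊕U12 sf)
  (λ (¬T24 , ¬U) → standardForm⇒≅ (WithoutMinors.standardForm M ¬T24 ¬U))
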